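{- Let $n \geq 2$ be a natural number and let $G_1, G_2, \ldots, G_n$ be arbitrary (finite, simple) graphs. Then $$\Gamma_3\Big(\bigoplus_{i=1}^{n} G_i\Big) \cong \bigoplus_{i=1}^n \Gamma_3(G_i) \;\oplus \bigoplus_{1\leq i,j\leq n,\ i\neq j} (\Gamma_2(G_i) \square G_j) \;\oplus \bigoplus_{1\leq i<j<k\leq n} (G_i \square G_j \square G_k).$$
   Context: All graphs are finite, simple and undirected. For a graph $G$ and a natural number $k$, the $k$-token graph $\Gamma_k(G)$ has as vertex set the collection of all $k$-element subsets of $V(G)$ (it is the graph with no vertices if $|V(G)|<k$), and two distinct $k$-subsets $A,B$ are adjacent if and only if $A \triangle B = \{x,y\}$ with $xy \in E(G)$. $\oplus$ (and $\bigoplus$) denotes disjoint union of graphs, and $G \square H$ denotes the Cartesian product: vertex set $V(G)\times V(H)$, with $(g,h)$ adjacent to $(g',h')$ iff either $g=g'$ and $hh' \in E(H)$, or $h=h'$ and $gg'\in E(G)$. -}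

module Defs where

open import Level using (0ℓ)
open import Data.Nat using (ℕ; zero; suc; _+_)
open import Data.Fin using (Fin; zero; suc)
open import Data.Fin.Properties using (0↔⊥; +↔⊎)
open import Data.Fin.Subset using (Subset; _∈_; _∉_; ∣_∣)
open import Data.Empty using (⊥)
open import Data.Bool using (Bool; true; false; if_then_else_)
open import Data.Sum using (_⊎_; inj₁; inj₂)
open import Data.Sum.Function.Propositional using (_⊎-↔_)
open import Data.Product using (Σ; _×_; _,_; proj₁; proj₂)
open import Relation.Nullary using (¬_)
open import Relation.Binary.PropositionalEquality using (_≡_)
open import Function using (_∘_)
open import Function.Bundles using (_↔_; _⇔_; Inverse)
open import Function.Properties.Inverse using (↔-sym; ↔-trans)

record Graph : Set₁ where
  field
    V : Set
    E : V → V → Set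
open Graph public

IsSimple : Graph → Set
IsSimple G = (∀ u v → E G u v → E G v u) × (∀ v → ¬ E G v v)

Finite : Graph → Set
Finite G = Σ ℕ λ m → V G ↔ Fin m

_≅_ : Graph → Graph → Set
G ≅ H = Σ (V G ↔ V H) λ f →
  ∀ u v → E G u v ⇔ E H (Inverse.to f u) (Inverse.to f v)

∅ : Graph
∅ = record { V = ⊥ ; E = λ _ _ → ⊥ }

_⊕_ : Graph → Graph → Graph
G ⊕ H = record { V = V G ⊎ V H ; E = EE }
  where
  EE : V G ⊎ V H → V G ⊎ V H → Set
  EE (inj₁ x) (inj₁ y) = E G x y
  EE (inj₂ x) (inj₂ y) = E H x y
  EE _ _ = ⊥

infixr 5 _⊕_
infixl 6 _□_

_□_ : Graph → Graph → Graph
G □ H = record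
  { V = V G × V H
  ; E = λ p q → (proj₁ p ≡ proj₁ q × E H (proj₂ p) (proj₂ q))
              ⊎ (proj₂ p ≡ proj₂ q × E G (proj₁ p) (proj₁ q)) }

⨁ : (n : ℕ) → (Fin n → Graph) → Graph
⨁ zero    G = ∅
⨁ (suc n) G = G zero ⊕ ⨁ n (G ∘ suc)

⊕-finite : (G H : Graph) → Finite G → Finite H → Finite (G ⊕ H)
⊕-finite G H (a , f) (b , g) = a + b , ↔-trans (f ⊎-↔ g) (↔-sym +↔⊎)

⨁-finite : (n : ℕ) (G : Fin n → Graph) → (∀ i → Finite (G i)) → Finite (⨁ n G)
⨁-finite zero    G fin = 0 , ↔-sym 0↔⊥
⨁-finite (suc n) G fin =
  ⊕-finite (G zero) (⨁ n (G ∘ suc)) (fin zero) (⨁-finite n (G ∘ suc) (fin ∘ suc))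

when : Bool → Graph → Graph
when b H = if b then H else ∅

-- k-token graph. Vertices: k-subsets of V(G) (encoded through the finiteness
-- witness as subsets of Fin m of size k). A ~ B iff A △ B = {x , y} with xy ∈ E.
Γ : ℕ → (G : Graph) → Finite G → Graph
Γ k G (m , f) = record { V = Σ (Subset m) (λ S → ∣ S ∣ ≡ k) ; E = TE }
  where
  c : V G → Fin m
  c = Inverse.to f
  TE : Σ (Subset m) (λ S → ∣ S ∣ ≡ k) → Σ (Subset m) (λ S → ∣ S ∣ ≡ k) → Set
  TE (A , _) (B , _) = Σ (V G) λ x → Σ (V G) λ y → E G x y ×
    (∀ v → ((c v ∈ A × c v ∉ B) ⊎ (c v ∉ A × c v ∈ B)) ⇔ (v ≡ x ⊎ v ≡ y))

{-# OPTIONS --safe #-}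
module Submission where

-- A k-token configuration of G ⊕ H is a pair of configurations, p tokens on G and q = k - p
-- on H, and since no edge joins G to H every token slide stays inside one of the two parts.
-- Hence Γ_k(G ⊕ H) ≅ ⨁_{p+q=k} Γ_p(G) □ Γ_q(H), where Γ_0 is the one-vertex graph and
-- Γ_1(G) ≅ G for simple G. Graphs up to isomorphism form a commutative semiring under ⊕ and □,
-- so splitting ⨁_i G_i as G_0 ⊕ ⨁_{i>0} G_i and inducting on n (first for k = 2, then k = 3)
-- sorts the summands into the three families of the statement.

open import Level using (0ℓ) renaming (suc to lsuc)
open import Algebra.Bundles using (CommutativeSemiring)
open import Algebra.Structures using (IsSemigroup)
open import Algebra.Structures.Biased using (isCommutativeMonoidʳ; isCommutativeSemiringʳ)
open import Data.Bool using (true; false; not; _∧_)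
open import Data.Bool.Properties using (∧-zeroʳ)
open import Data.Empty using (⊥; ⊥-elim)
open import Data.Fin using (Fin; zero; suc; _↑ˡ_; _↑ʳ_; _≟_; _<?_)
open import Data.Fin.Properties using (0↔⊥)
open import Data.Fin.Subset using (Subset; _∈_; ∣_∣; ⁅_⁆) renaming (⊥ to ∅ˢ)
open import Data.Fin.Subset.Properties
  using (_∈?_; ⊆-antisym; ∉⊥; ∣⊥∣≡0; x∈⁅x⁆; x∈⁅y⁆⇒x≡y; x∈⁅y⁆⇔x≡y; ∣⁅x⁆∣≡1)
open import Data.Nat as ℕ using (ℕ; _≤_; _+_; z≤n)
import Data.Nat.Properties as ℕ
open import Data.Product as Product using (Σ; _×_; _,_; proj₁; proj₂)
open import Data.Product.Function.NonDependent.Propositional using (_×-⇔_)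
open import Data.Sum as Sum using (_⊎_; inj₁; inj₂; [_,_])
open import Data.Sum.Function.Propositional using (_⊎-⇔_)
open import Data.Sum.Properties using (swap-involutive; inj₁-injective; inj₂-injective)
open import Data.Unit using (⊤; tt)
open import Data.Vec using ([]; _∷_; _++_; take; drop)
open import Data.Vec.Properties
  using (lookup-++ˡ; lookup-++ʳ; []=⇒lookup; lookup⇒[]=; take++drop≡id; ++-injectiveˡ;
         ++-injectiveʳ)
open import Function using (_∘_; id)
open import Function.Bundles using (_↔_; _⇔_; Inverse; Equivalence; Injection; mk↔ₛ′; mk⇔)
import Function.Properties.Equivalence as ⇔
open import Function.Properties.Inverse using (↔⇒↣; ↔-sym)
open import Function.Related.TypeIsomorphisms using (¬-cong-⇔)
open import Relation.Binary.Bundles using (Setoid)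
open import Relation.Binary.Structures using (IsEquivalence)
open import Relation.Binary.PropositionalEquality
  using (_≡_; refl; sym; trans; cong; cong₂; subst; subst₂; module ≡-Reasoning)
open import Relation.Nullary using (¬_; Dec; yes; no)
open import Relation.Nullary.Decidable using (⌊_⌋; ⌊⌋-map′)

open import Defs

-- Unlike the Σ-type _≅_, the record type G ≃ H determines G and H, so Agda can infer them.
infix 4 _≃_

record _≃_ (G H : Graph) : Set₁ where
  field
    to        : V G → V H
    from      : V H → V G
    to∘from   : ∀ y → to (from y) ≡ y
    from∘to   : ∀ x → from (to x) ≡ x
    to-edge   : ∀ {u v} → E G u v → E H (to u) (to v)
    from-edge : ∀ {u v} → E H u v → E G (from u) (from v)

≃⇒≅ : {G H : Graph} → G ≃ H → G ≅ H
≃⇒≅ {G} i = mk↔ₛ′ to from to∘from from∘to , λ u v →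
  mk⇔ to-edge (λ e → subst₂ (E G) (from∘to u) (from∘to v) (from-edge e))
  where open _≃_ i

≃-refl : {G : Graph} → G ≃ G
≃-refl = record
  { to = id ; from = id ; to∘from = λ _ → refl ; from∘to = λ _ → refl
  ; to-edge = id ; from-edge = id }

≃-sym : {G H : Graph} → G ≃ H → H ≃ G
≃-sym i = record
  { to = from ; from = to ; to∘from = from∘to ; from∘to = to∘from
  ; to-edge = from-edge ; from-edge = to-edge }
  where open _≃_ i

≃-trans : {G H K : Graph} → G ≃ H → H ≃ K → G ≃ K
≃-trans i j = record
  { to        = j.to ∘ i.to
  ; from      = i.from ∘ j.from
  ; to∘from   = λ y → trans (cong j.to (i.to∘from (j.from y))) (j.to∘from y)
  ; from∘to   = λ x → trans (cong i.from (j.from∘to (i.to x))) (i.from∘to x)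
  ; to-edge   = j.to-edge ∘ i.to-edge
  ; from-edge = i.from-edge ∘ j.from-edge
  }
  where module i = _≃_ i; module j = _≃_ j

≃-isEquivalence : IsEquivalence _≃_
≃-isEquivalence = record { refl = ≃-refl ; sym = ≃-sym ; trans = ≃-trans }

≃-setoid : Setoid (lsuc 0ℓ) (lsuc 0ℓ)
≃-setoid = record { isEquivalence = ≃-isEquivalence }

-- Graphs up to isomorphism form a commutative semiring

K₁ : Graph
K₁ = record { V = ⊤ ; E = λ _ _ → ⊥ }

⊕-cong : {G G′ H H′ : Graph} → G ≃ G′ → H ≃ H′ → G ⊕ H ≃ G′ ⊕ H′
⊕-cong i j = record
  { to        = Sum.map i.to j.to
  ; from      = Sum.map i.from j.from
  ; to∘from   = [ cong inj₁ ∘ i.to∘from , cong inj₂ ∘ j.to∘from ]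
  ; from∘to   = [ cong inj₁ ∘ i.from∘to , cong inj₂ ∘ j.from∘to ]
  ; to-edge   = λ { {inj₁ _} {inj₁ _} e → i.to-edge e ; {inj₂ _} {inj₂ _} e → j.to-edge e }
  ; from-edge = λ { {inj₁ _} {inj₁ _} e → i.from-edge e ; {inj₂ _} {inj₂ _} e → j.from-edge e }
  }
  where module i = _≃_ i; module j = _≃_ j

⊕-assoc : (A B C : Graph) → (A ⊕ B) ⊕ C ≃ A ⊕ (B ⊕ C)
⊕-assoc A B C = record
  { to        = Sum.assocʳ
  ; from      = Sum.assocˡ
  ; to∘from   = λ { (inj₁ _) → refl ; (inj₂ (inj₁ _)) → refl ; (inj₂ (inj₂ _)) → refl }
  ; from∘to   = λ { (inj₁ (inj₁ _)) → refl ; (inj₁ (inj₂ _)) → refl ; (inj₂ _) → refl }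
  ; to-edge   = λ { {inj₁ (inj₁ _)} {inj₁ (inj₁ _)} e → e ; {inj₁ (inj₂ _)} {inj₁ (inj₂ _)} e → e
                  ; {inj₂ _} {inj₂ _} e → e }
  ; from-edge = λ { {inj₁ _} {inj₁ _} e → e ; {inj₂ (inj₁ _)} {inj₂ (inj₁ _)} e → e
                  ; {inj₂ (inj₂ _)} {inj₂ (inj₂ _)} e → e }
  }

⊕-comm : (A B : Graph) → A ⊕ B ≃ B ⊕ A
⊕-comm A B = record
  { to        = Sum.swap
  ; from      = Sum.swap
  ; to∘from   = swap-involutive
  ; from∘to   = swap-involutive
  ; to-edge   = λ { {inj₁ _} {inj₁ _} e → e ; {inj₂ _} {inj₂ _} e → e }
  ; from-edge = λ { {inj₁ _} {inj₁ _} e → e ; {inj₂ _} {inj₂ _} e → e }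
  }

⊕-identityʳ : (A : Graph) → A ⊕ ∅ ≃ A
⊕-identityʳ A = record
  { to        = [ id , (λ ()) ]
  ; from      = inj₁
  ; to∘from   = λ _ → refl
  ; from∘to   = λ { (inj₁ _) → refl }
  ; to-edge   = λ { {inj₁ _} {inj₁ _} e → e }
  ; from-edge = id
  }

□-cong : {G G′ H H′ : Graph} → G ≃ G′ → H ≃ H′ → G □ H ≃ G′ □ H′
□-cong i j = record
  { to        = Product.map i.to j.to
  ; from      = Product.map i.from j.from
  ; to∘from   = λ (x , y) → cong₂ _,_ (i.to∘from x) (j.to∘from y)
  ; from∘to   = λ (x , y) → cong₂ _,_ (i.from∘to x) (j.from∘to y)
  ; to-edge   = Sum.map (Product.map (cong i.to) j.to-edge) (Product.map (cong j.to) i.to-edge)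
  ; from-edge =
      Sum.map (Product.map (cong i.from) j.from-edge) (Product.map (cong j.from) i.from-edge)
  }
  where module i = _≃_ i; module j = _≃_ j

□-assoc : (A B C : Graph) → A □ B □ C ≃ A □ (B □ C)
□-assoc A B C = record
  { to        = Product.assocʳ′
  ; from      = Product.assocˡ′
  ; to∘from   = λ _ → refl
  ; from∘to   = λ _ → refl
  ; to-edge   = λ { (inj₁ (p , e))          → inj₁ (cong proj₁ p , inj₁ (cong proj₂ p , e))
                  ; (inj₂ (q , inj₁ (p , e))) → inj₁ (p , inj₂ (q , e))
                  ; (inj₂ (q , inj₂ (p , e))) → inj₂ (cong₂ _,_ p q , e) }
  ; from-edge = λ { (inj₁ (p , inj₁ (q , e))) → inj₁ (cong₂ _,_ p q , e)
                  ; (inj₁ (p , inj₂ (q , e))) → inj₂ (q , inj₁ (p , e))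
                  ; (inj₂ (p , e))          → inj₂ (cong proj₂ p , inj₂ (cong proj₁ p , e)) }
  }

□-comm : (A B : Graph) → A □ B ≃ B □ A
□-comm A B = record
  { to        = Product.swap
  ; from      = Product.swap
  ; to∘from   = λ _ → refl
  ; from∘to   = λ _ → refl
  ; to-edge   = Sum.swap
  ; from-edge = Sum.swap
  }

□-identityʳ : (A : Graph) → A □ K₁ ≃ A
□-identityʳ A = record
  { to        = proj₁
  ; from      = _, tt
  ; to∘from   = λ _ → refl
  ; from∘to   = λ _ → refl
  ; to-edge   = λ { (inj₂ (_ , e)) → e }
  ; from-edge = λ e → inj₂ (refl , e)
  }

□-zeroʳ : (A : Graph) → A □ ∅ ≃ ∅
□-zeroʳ A = record
  { to        = λ ()
  ; from      = λ ()
  ; to∘from   = λ ()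
  ; from∘to   = λ ()
  ; to-edge   = λ { {_ , ()} }
  ; from-edge = λ { {()} }
  }

□-distribˡ-⊕ : (A B C : Graph) → A □ (B ⊕ C) ≃ (A □ B) ⊕ (A □ C)
□-distribˡ-⊕ A B C = record
  { to        = λ { (a , inj₁ b) → inj₁ (a , b) ; (a , inj₂ c) → inj₂ (a , c) }
  ; from      = [ Product.map₂ inj₁ , Product.map₂ inj₂ ]
  ; to∘from   = [ (λ _ → refl) , (λ _ → refl) ]
  ; from∘to   = λ { (_ , inj₁ _) → refl ; (_ , inj₂ _) → refl }
  ; to-edge   = λ { {_ , inj₁ _} {_ , inj₁ _} (inj₁ pe) → inj₁ pe
                  ; {_ , inj₁ _} {_ , inj₁ _} (inj₂ (refl , e)) → inj₂ (refl , e)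
                  ; {_ , inj₂ _} {_ , inj₂ _} (inj₁ pe) → inj₁ pe
                  ; {_ , inj₂ _} {_ , inj₂ _} (inj₂ (refl , e)) → inj₂ (refl , e)
                  ; {_ , inj₁ _} {_ , inj₂ _} (inj₂ (() , _))
                  ; {_ , inj₂ _} {_ , inj₁ _} (inj₂ (() , _)) }
  ; from-edge = λ { {inj₁ _} {inj₁ _} (inj₁ pe) → inj₁ pe
                  ; {inj₁ _} {inj₁ _} (inj₂ (refl , e)) → inj₂ (refl , e)
                  ; {inj₂ _} {inj₂ _} (inj₁ pe) → inj₁ pe
                  ; {inj₂ _} {inj₂ _} (inj₂ (refl , e)) → inj₂ (refl , e) }
  }

⊕-□-commutativeSemiring : CommutativeSemiring (lsuc 0ℓ) (lsuc 0ℓ)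
⊕-□-commutativeSemiring = record
  { Carrier               = Graph
  ; _≈_                   = _≃_
  ; _+_                   = _⊕_
  ; _*_                   = _□_
  ; 0#                    = ∅
  ; 1#                    = K₁
  ; isCommutativeSemiring = isCommutativeSemiringʳ record
    { +-isCommutativeMonoid = isCommutativeMonoidʳ record
      { isSemigroup = semigroup ⊕-cong ⊕-assoc ; identityʳ = ⊕-identityʳ ; comm = ⊕-comm }
    ; *-isCommutativeMonoid = isCommutativeMonoidʳ record
      { isSemigroup = semigroup □-cong □-assoc ; identityʳ = □-identityʳ ; comm = □-comm }
    ; distribˡ = □-distribˡ-⊕
    ; zeroʳ    = □-zeroʳ
    }
  }
  where
  semigroup : {_∙_ : Graph → Graph → Graph} →
    (∀ {G G′ H H′} → G ≃ G′ → H ≃ H′ → G ∙ H ≃ G′ ∙ H′) →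
    (∀ A B C → (A ∙ B) ∙ C ≃ A ∙ (B ∙ C)) → IsSemigroup _≃_ _∙_
  semigroup ∙-cong assoc = record
    { isMagma = record { isEquivalence = ≃-isEquivalence ; ∙-cong = ∙-cong } ; assoc = assoc }

open CommutativeSemiring ⊕-□-commutativeSemiring using (semiring; +-commutativeMonoid)
  renaming (+-congˡ to ⊕-congˡ; +-identityˡ to ⊕-identityˡ; *-identityˡ to □-identityˡ)
open import Algebra.Properties.Semiring.Sum semiring
  using (sum; sum-cong-≋; ∑-distrib-+; sum-replicate-zero; *-distribˡ-sum; *-distribʳ-sum)
open import Algebra.Solver.CommutativeMonoid +-commutativeMonoid
  using (solve; _⊜_) renaming (_⊕_ to _⊕ₑ_)

⨁≡sum : ∀ n (F : Fin n → Graph) → ⨁ n F ≡ sum F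
⨁≡sum ℕ.zero    F = refl
⨁≡sum (ℕ.suc n) F = cong (F zero ⊕_) (⨁≡sum n (F ∘ suc))

⨁-cong : ∀ n {F F′ : Fin n → Graph} → (∀ i → F i ≃ F′ i) → ⨁ n F ≃ ⨁ n F′
⨁-cong n {F} {F′} h rewrite ⨁≡sum n F | ⨁≡sum n F′ = sum-cong-≋ h

⨁-distrib-⊕ : ∀ n (F H : Fin n → Graph) → ⨁ n (λ i → F i ⊕ H i) ≃ ⨁ n F ⊕ ⨁ n H
⨁-distrib-⊕ n F H rewrite ⨁≡sum n (λ i → F i ⊕ H i) | ⨁≡sum n F | ⨁≡sum n H = ∑-distrib-+ F H

⨁-zero : ∀ n → ⨁ n (λ _ → ∅) ≃ ∅
⨁-zero n rewrite ⨁≡sum n (λ _ → ∅) = sum-replicate-zero n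

□-distribˡ-⨁ : ∀ n A (F : Fin n → Graph) → A □ ⨁ n F ≃ ⨁ n (λ i → A □ F i)
□-distribˡ-⨁ n A F rewrite ⨁≡sum n F | ⨁≡sum n (λ i → A □ F i) = *-distribˡ-sum A F

□-distribʳ-⨁ : ∀ n A (F : Fin n → Graph) → ⨁ n F □ A ≃ ⨁ n (λ i → F i □ A)
□-distribʳ-⨁ n A F rewrite ⨁≡sum n F | ⨁≡sum n (λ i → F i □ A) = *-distribʳ-sum A F

when-≃ : ∀ {b b′ H H′} → b ≡ b′ → H ≃ H′ → when b H ≃ when b′ H′
when-≃ {true}  refl H≃H′ = H≃H′
when-≃ {false} refl _    = ≃-refl

□-when : ∀ A b H → A □ when b H ≃ when b (A □ H)
□-when A true  H = ≃-refl
□-when A false H = □-zeroʳ A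

Xor : Set → Set → Set
Xor P Q = (P × ¬ Q) ⊎ (¬ P × Q)

Xor-irrefl : {P : Set} → ¬ Xor P P
Xor-irrefl (inj₁ (p , ¬p)) = ¬p p
Xor-irrefl (inj₂ (¬p , p)) = ¬p p

Xor-sym : {P Q : Set} → Xor P Q → Xor Q P
Xor-sym = Sum.swap ∘ Sum.map Product.swap Product.swap

Xor-cong : {P P′ Q Q′ : Set} → P ⇔ P′ → Q ⇔ Q′ → Xor P Q ⇔ Xor P′ Q′
Xor-cong P⇔P′ Q⇔Q′ = (P⇔P′ ×-⇔ ¬-cong-⇔ Q⇔Q′) ⊎-⇔ (¬-cong-⇔ P⇔P′ ×-⇔ Q⇔Q′)

Xor⇔⊎ : {P Q : Set} → ¬ (P × Q) → Xor P Q ⇔ (P ⊎ Q)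
Xor⇔⊎ ¬pq = mk⇔ (Sum.map proj₁ proj₂)
  [ (λ p → inj₁ (p , λ q → ¬pq (p , q))) , (λ q → inj₂ ((λ p → ¬pq (p , q)) , q)) ]

¬Xor⇒⊆ : ∀ {m} {s t : Subset m} → (∀ i → ¬ Xor (i ∈ s) (i ∈ t)) → ∀ {i} → i ∈ s → i ∈ t
¬Xor⇒⊆ {t = t} ¬xor {i} i∈s with i ∈? t
... | yes i∈t = i∈t
... | no  i∉t = ⊥-elim (¬xor i (inj₁ (i∈s , i∉t)))

¬Xor⇒≡ : ∀ {m} {s t : Subset m} → (∀ i → ¬ Xor (i ∈ s) (i ∈ t)) → s ≡ t
¬Xor⇒≡ ¬xor = ⊆-antisym (¬Xor⇒⊆ ¬xor) (¬Xor⇒⊆ λ i → ¬xor i ∘ Xor-sym)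

∣p∣≡0⇒p≡⊥ : ∀ {m} (p : Subset m) → ∣ p ∣ ≡ 0 → p ≡ ∅ˢ
∣p∣≡0⇒p≡⊥ []          _ = refl
∣p∣≡0⇒p≡⊥ (false ∷ p) ∣p∣≡0 = cong (false ∷_) (∣p∣≡0⇒p≡⊥ p ∣p∣≡0)

∣p∣≡1⇒p≡⁅x⁆ : ∀ {m} (p : Subset m) → ∣ p ∣ ≡ 1 → Σ (Fin m) λ x → p ≡ ⁅ x ⁆
∣p∣≡1⇒p≡⁅x⁆ (true ∷ p)  ∣p∣≡1 = zero , cong (true ∷_) (∣p∣≡0⇒p≡⊥ p (ℕ.suc-injective ∣p∣≡1))
∣p∣≡1⇒p≡⁅x⁆ (false ∷ p) ∣p∣≡1 = Product.map suc (cong (false ∷_)) (∣p∣≡1⇒p≡⁅x⁆ p ∣p∣≡1)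

∀-↔ : ∀ {X : Set} {m} (h : X ↔ Fin m) {P : Fin m → Set} → (∀ x → P (Inverse.to h x)) → ∀ i → P i
∀-↔ h {P} p i = subst P (Inverse.strictlyInverseˡ h i) (p (Inverse.from h i))

inj₁-⇔ : {A B : Set} {v x y : A} →
  (_≡_ {A = A ⊎ B} (inj₁ v) (inj₁ x) ⊎ _≡_ {A = A ⊎ B} (inj₁ v) (inj₁ y)) ⇔ (v ≡ x ⊎ v ≡ y)
inj₁-⇔ = mk⇔ (Sum.map inj₁-injective inj₁-injective) (Sum.map (cong inj₁) (cong inj₁))

inj₂-⇔ : {A B : Set} {v x y : B} →
  (_≡_ {A = A ⊎ B} (inj₂ v) (inj₂ x) ⊎ _≡_ {A = A ⊎ B} (inj₂ v) (inj₂ y)) ⇔ (v ≡ x ⊎ v ≡ y)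
inj₂-⇔ = mk⇔ (Sum.map inj₂-injective inj₂-injective) (Sum.map (cong inj₂) (cong inj₂))

↑ˡ∈++⇔∈ : ∀ {a b} (s : Subset a) (t : Subset b) i → i ↑ˡ b ∈ s ++ t ⇔ i ∈ s
↑ˡ∈++⇔∈ s t i = mk⇔
  (λ i∈ → lookup⇒[]= i s (trans (sym (lookup-++ˡ s t i)) ([]=⇒lookup i∈)))
  (λ i∈ → lookup⇒[]= _ (s ++ t) (trans (lookup-++ˡ s t i) ([]=⇒lookup i∈)))

↑ʳ∈++⇔∈ : ∀ {a b} (s : Subset a) (t : Subset b) j → a ↑ʳ j ∈ s ++ t ⇔ j ∈ t
↑ʳ∈++⇔∈ s t j = mk⇔
  (λ j∈ → lookup⇒[]= j t (trans (sym (lookup-++ʳ s t j)) ([]=⇒lookup j∈)))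
  (λ j∈ → lookup⇒[]= _ (s ++ t) (trans (lookup-++ʳ s t j) ([]=⇒lookup j∈)))

∣p++q∣≡∣p∣+∣q∣ : ∀ {a b} (p : Subset a) (q : Subset b) → ∣ p ++ q ∣ ≡ ∣ p ∣ + ∣ q ∣
∣p++q∣≡∣p∣+∣q∣ []          q = refl
∣p++q∣≡∣p∣+∣q∣ (true ∷ p)  q = cong ℕ.suc (∣p++q∣≡∣p∣+∣q∣ p q)
∣p++q∣≡∣p∣+∣q∣ (false ∷ p) q = ∣p++q∣≡∣p∣+∣q∣ p q

take-++ : ∀ {a b} (p : Subset a) (q : Subset b) → take a (p ++ q) ≡ p
take-++ {a} p q = ++-injectiveˡ _ p (take++drop≡id a (p ++ q))

drop-++ : ∀ {a b} (p : Subset a) (q : Subset b) → drop a (p ++ q) ≡ q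
drop-++ {a} p q = ++-injectiveʳ _ p (take++drop≡id a (p ++ q))

-- Token graphs

Tokens : ℕ → ℕ → Set
Tokens m k = Σ (Subset m) λ S → ∣ S ∣ ≡ k

tokens-≡ : ∀ {m k} {S T : Subset m} {p : ∣ S ∣ ≡ k} {q : ∣ T ∣ ≡ k} →
  S ≡ T → _≡_ {A = Tokens m k} (S , p) (T , q)
tokens-≡ {p = p} {q} refl = cong (_ ,_) (ℕ.≡-irrelevant p q)

-- The adjacency of Γ k G (m , f), read on the underlying subsets of Fin m.
Slide : (G : Graph) {m : ℕ} → V G ↔ Fin m → Subset m → Subset m → Set
Slide G f A B = Σ (V G) λ x → Σ (V G) λ y → E G x y ×
  (∀ v → Xor (Inverse.to f v ∈ A) (Inverse.to f v ∈ B) ⇔ (v ≡ x ⊎ v ≡ y))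

Γ-∅ : ∀ k (f : ⊥ ↔ Fin 0) → Γ (ℕ.suc k) ∅ (0 , f) ≃ ∅
Γ-∅ k f = record
  { to = λ { ([] , ()) } ; from = λ () ; to∘from = λ () ; from∘to = λ { ([] , ()) }
  ; to-edge = λ { {[] , ()} } ; from-edge = λ { {()} } }

Γ-zero : (G : Graph) (w : Finite G) → Γ 0 G w ≃ K₁
Γ-zero G (m , f) = record
  { to        = λ _ → tt
  ; from      = λ _ → ∅ˢ , ∣⊥∣≡0 m
  ; to∘from   = λ _ → refl
  ; from∘to   = λ (S , ∣S∣≡0) → tokens-≡ (sym (∣p∣≡0⇒p≡⊥ S ∣S∣≡0))
  ; to-edge   = λ { {A , ∣A∣≡0} {B , ∣B∣≡0} (x , _ , _ , xor) →
                    [ ∉empty ∣A∣≡0 ∘ proj₁ , ∉empty ∣B∣≡0 ∘ proj₂ ]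
                      (Equivalence.from (xor x) (inj₁ refl)) }
  ; from-edge = λ ()
  }
  where
  ∉empty : ∀ {S : Subset m} {i} → ∣ S ∣ ≡ 0 → ¬ i ∈ S
  ∉empty {S} ∣S∣≡0 rewrite ∣p∣≡0⇒p≡⊥ S ∣S∣≡0 = ∉⊥

Γ-one : (G : Graph) (w : Finite G) → IsSimple G → Γ 1 G w ≃ G
Γ-one G (m , f) (E-sym , E-irrefl) = record
  { to        = to
  ; from      = from
  ; to∘from   = λ v → trans (cong c⁻¹ (sym (⁅⁆-injective (proj₂ (element (from v)))))) (c⁻¹∘c v)
  ; from∘to   = λ u → tokens-≡ (sym (is-⁅to⁆ u))
  ; to-edge   = λ {u} {v} slide → slide-⁅⁆⇒E (subst₂ (Slide G f) (is-⁅to⁆ u) (is-⁅to⁆ v) slide)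
  ; from-edge = E⇒slide-⁅⁆
  }
  where
  c = Inverse.to f
  c⁻¹ = Inverse.from f
  c∘c⁻¹ = Inverse.strictlyInverseˡ f
  c⁻¹∘c = Inverse.strictlyInverseʳ f

  element : (S : Tokens m 1) → Σ (Fin m) λ i → proj₁ S ≡ ⁅ i ⁆
  element (S , ∣S∣≡1) = ∣p∣≡1⇒p≡⁅x⁆ S ∣S∣≡1

  to : Tokens m 1 → V G
  to = c⁻¹ ∘ proj₁ ∘ element

  from : V G → Tokens m 1
  from v = ⁅ c v ⁆ , ∣⁅x⁆∣≡1 (c v)

  ⁅⁆-injective : ∀ {i j : Fin m} → ⁅ i ⁆ ≡ ⁅ j ⁆ → i ≡ j
  ⁅⁆-injective {i} ⁅i⁆≡⁅j⁆ = x∈⁅y⁆⇒x≡y _ (subst (i ∈_) ⁅i⁆≡⁅j⁆ (x∈⁅x⁆ i))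

  is-⁅to⁆ : (S : Tokens m 1) → proj₁ S ≡ ⁅ c (to S) ⁆
  is-⁅to⁆ S = trans (proj₂ (element S)) (cong ⁅_⁆ (sym (c∘c⁻¹ _)))

  ∈⁅⁆⇔≡ : ∀ v a → c v ∈ ⁅ c a ⁆ ⇔ v ≡ a
  ∈⁅⁆⇔≡ v a = ⇔.trans x∈⁅y⁆⇔x≡y (mk⇔ (Injection.injective (↔⇒↣ f)) (cong c))

  xor-⁅⁆ : ∀ a b v → Xor (c v ∈ ⁅ c a ⁆) (c v ∈ ⁅ c b ⁆) ⇔ Xor (v ≡ a) (v ≡ b)
  xor-⁅⁆ a b v = Xor-cong (∈⁅⁆⇔≡ v a) (∈⁅⁆⇔≡ v b)

  in-⁅⁆-or-⁅⁆ : ∀ {a b} v → Xor (c v ∈ ⁅ c a ⁆) (c v ∈ ⁅ c b ⁆) → v ≡ a ⊎ v ≡ b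
  in-⁅⁆-or-⁅⁆ {a} {b} v = Sum.map proj₁ proj₂ ∘ Equivalence.to (xor-⁅⁆ a b v)

  slide-⁅⁆⇒E : ∀ {a b} → Slide G f ⁅ c a ⁆ ⁅ c b ⁆ → E G a b
  slide-⁅⁆⇒E (x , y , e , xor) with in-⁅⁆-or-⁅⁆ x (Equivalence.from (xor x) (inj₁ refl))
                                 | in-⁅⁆-or-⁅⁆ y (Equivalence.from (xor y) (inj₂ refl))
  ... | inj₁ refl | inj₂ refl = e
  ... | inj₂ refl | inj₁ refl = E-sym _ _ e
  ... | inj₁ refl | inj₁ refl = ⊥-elim (E-irrefl _ e)
  ... | inj₂ refl | inj₂ refl = ⊥-elim (E-irrefl _ e)

  E⇒slide-⁅⁆ : ∀ {a b} → E G a b → Slide G f ⁅ c a ⁆ ⁅ c b ⁆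
  E⇒slide-⁅⁆ {a} {b} e = a , b , e , λ v →
    ⇔.trans (xor-⁅⁆ a b v) (Xor⇔⊎ λ { (refl , refl) → E-irrefl _ e })

-- ⊕-finite enumerates V G before V H, so a subset of Fin (a + b) is s ++ t with s ⊆ Fin a
-- and t ⊆ Fin b.
module _ (G H : Graph) {a b : ℕ} (f : V G ↔ Fin a) (g : V H ↔ Fin b) where

  private
    F = proj₂ (⊕-finite G H (a , f) (b , g))
    cf = Inverse.to f
    cg = Inverse.to g

    xor-↑ˡ : ∀ (s s′ : Subset a) (t t′ : Subset b) i →
      Xor (i ↑ˡ b ∈ s ++ t) (i ↑ˡ b ∈ s′ ++ t′) ⇔ Xor (i ∈ s) (i ∈ s′)
    xor-↑ˡ s s′ t t′ i = Xor-cong (↑ˡ∈++⇔∈ s t i) (↑ˡ∈++⇔∈ s′ t′ i)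

    xor-↑ʳ : ∀ (s s′ : Subset a) (t t′ : Subset b) j →
      Xor (a ↑ʳ j ∈ s ++ t) (a ↑ʳ j ∈ s′ ++ t′) ⇔ Xor (j ∈ t) (j ∈ t′)
    xor-↑ʳ s s′ t t′ j = Xor-cong (↑ʳ∈++⇔∈ s t j) (↑ʳ∈++⇔∈ s′ t′ j)

  SplitSlide : Subset a × Subset b → Subset a × Subset b → Set
  SplitSlide (s , t) (s′ , t′) = (s ≡ s′ × Slide H g t t′) ⊎ (t ≡ t′ × Slide G f s s′)

  slide-⊕⇒split : ∀ {s s′ : Subset a} {t t′ : Subset b} →
    Slide (G ⊕ H) F (s ++ t) (s′ ++ t′) → SplitSlide (s , t) (s′ , t′)
  slide-⊕⇒split {s} {s′} {t} {t′} (inj₁ x , inj₁ y , e , xor) =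
    inj₂ (¬Xor⇒≡ (∀-↔ g untouched) , x , y , e , λ v →
      ⇔.trans (⇔.sym (xor-↑ˡ s s′ t t′ (cf v))) (⇔.trans (xor (inj₁ v)) inj₁-⇔))
    where
    untouched : ∀ w → ¬ Xor (cg w ∈ t) (cg w ∈ t′)
    untouched w = [ (λ ()) , (λ ()) ] ∘ Equivalence.to (xor (inj₂ w))
                                      ∘ Equivalence.from (xor-↑ʳ s s′ t t′ (cg w))
  slide-⊕⇒split {s} {s′} {t} {t′} (inj₂ x , inj₂ y , e , xor) =
    inj₁ (¬Xor⇒≡ (∀-↔ f untouched) , x , y , e , λ v →
      ⇔.trans (⇔.sym (xor-↑ʳ s s′ t t′ (cg v))) (⇔.trans (xor (inj₂ v)) inj₂-⇔))
    where
    untouched : ∀ w → ¬ Xor (cf w ∈ s) (cf w ∈ s′)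
    untouched w = [ (λ ()) , (λ ()) ] ∘ Equivalence.to (xor (inj₁ w))
                                      ∘ Equivalence.from (xor-↑ˡ s s′ t t′ (cf w))

  split⇒slide-⊕ : ∀ {s s′ : Subset a} {t t′ : Subset b} →
    SplitSlide (s , t) (s′ , t′) → Slide (G ⊕ H) F (s ++ t) (s′ ++ t′)
  split⇒slide-⊕ {s} {s′} {t} (inj₂ (refl , x , y , e , xor)) = inj₁ x , inj₁ y , e , λ
    { (inj₁ v) → ⇔.trans (xor-↑ˡ s s′ t t (cf v)) (⇔.trans (xor v) (⇔.sym inj₁-⇔))
    ; (inj₂ w) → mk⇔ (⊥-elim ∘ Xor-irrefl ∘ Equivalence.to (xor-↑ʳ s s′ t t (cg w)))
                     [ (λ ()) , (λ ()) ] }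
  split⇒slide-⊕ {s} {_} {t} {t′} (inj₁ (refl , x , y , e , xor)) = inj₂ x , inj₂ y , e , λ
    { (inj₂ w) → ⇔.trans (xor-↑ʳ s s t t′ (cg w)) (⇔.trans (xor w) (⇔.sym inj₂-⇔))
    ; (inj₁ v) → mk⇔ (⊥-elim ∘ Xor-irrefl ∘ Equivalence.to (xor-↑ˡ s s t t′ (cf v)))
                     [ (λ ()) , (λ ()) ] }

  -- Γ-convolution p q = ⨁_{i ≤ p} Γ (p ∸ i) G □ Γ (q + i) H.
  Γ-convolution : ℕ → ℕ → Graph
  Γ-convolution ℕ.zero    q = Γ 0 G (a , f) □ Γ q H (b , g)
  Γ-convolution (ℕ.suc p) q = (Γ (ℕ.suc p) G (a , f) □ Γ q H (b , g)) ⊕ Γ-convolution p (ℕ.suc q)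

  TokenPairs : ℕ → ℕ → Graph
  TokenPairs p q = record
    { V = Σ (Subset a × Subset b) λ (s , t) → ∣ s ∣ + ∣ t ∣ ≡ p + q × q ≤ ∣ t ∣
    ; E = λ u v → SplitSlide (proj₁ u) (proj₁ v)
    }

  private
    pair-≡ : ∀ {p q} {st st′ : Subset a × Subset b} {x y} → st ≡ st′ →
      _≡_ {A = V (TokenPairs p q)} (st , x) (st′ , y)
    pair-≡ {x = e , l} {e′ , l′} refl =
      cong₂ (λ e l → _ , e , l) (ℕ.≡-irrelevant e e′) (ℕ.≤-irrelevant l l′)

    split⇒□ : ∀ {p q s s′ t t′}
      {∣s∣ : ∣ s ∣ ≡ p} {∣s′∣ : ∣ s′ ∣ ≡ p} {∣t∣ : ∣ t ∣ ≡ q} {∣t′∣ : ∣ t′ ∣ ≡ q} →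
      SplitSlide (s , t) (s′ , t′) →
      E (Γ p G (a , f) □ Γ q H (b , g)) ((s , ∣s∣) , (t , ∣t∣)) ((s′ , ∣s′∣) , (t′ , ∣t′∣))
    split⇒□ = Sum.map (Product.map₁ tokens-≡) (Product.map₁ tokens-≡)

    □⇒split : ∀ {p q s s′ t t′}
      {∣s∣ : ∣ s ∣ ≡ p} {∣s′∣ : ∣ s′ ∣ ≡ p} {∣t∣ : ∣ t ∣ ≡ q} {∣t′∣ : ∣ t′ ∣ ≡ q} →
      E (Γ p G (a , f) □ Γ q H (b , g)) ((s , ∣s∣) , (t , ∣t∣)) ((s′ , ∣s′∣) , (t′ , ∣t′∣)) →
      SplitSlide (s , t) (s′ , t′)
    □⇒split = Sum.map (Product.map₁ (cong proj₁)) (Product.map₁ (cong proj₁))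

    tokens-on-H-invariant : ∀ {p q} {u v : V (TokenPairs p q)} → E (TokenPairs p q) u v →
      ∣ proj₂ (proj₁ u) ∣ ≡ ∣ proj₂ (proj₁ v) ∣
    tokens-on-H-invariant {u = _ , sizes , _} {_ , sizes′ , _} (inj₁ (refl , _)) =
      ℕ.+-cancelˡ-≡ _ _ _ (trans sizes (sym sizes′))
    tokens-on-H-invariant (inj₂ (refl , _)) = refl

  TokenPairs-zero : ∀ q → TokenPairs 0 q ≃ Γ 0 G (a , f) □ Γ q H (b , g)
  TokenPairs-zero q = record
    { to        = λ ((s , t) , sizes , q≤∣t∣) → let ∣s∣≡0 = no-tokens-on-G sizes q≤∣t∣ in
                    (s , ∣s∣≡0) , (t , trans (cong (_+ ∣ t ∣) (sym ∣s∣≡0)) sizes)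
    ; from      = from
    ; to∘from   = λ _ → cong₂ _,_ (tokens-≡ refl) (tokens-≡ refl)
    ; from∘to   = λ _ → pair-≡ refl
    ; to-edge   = split⇒□
    ; from-edge = □⇒split
    }
    where
    no-tokens-on-G : ∀ {x y} → x + y ≡ q → q ≤ y → x ≡ 0
    no-tokens-on-G {x} {y} refl q≤y = ℕ.n≤0⇒n≡0 (ℕ.+-cancelʳ-≤ y x 0 q≤y)

    from : V (Γ 0 G (a , f) □ Γ q H (b , g)) → V (TokenPairs 0 q)
    from ((s , ∣s∣) , (t , ∣t∣)) = (s , t) , cong₂ _+_ ∣s∣ ∣t∣ , ℕ.≤-reflexive (sym ∣t∣)

  -- By tokens-on-H-invariant, the configurations with exactly q tokens on H form a union of
  -- components.
  TokenPairs-suc : ∀ p q →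
    TokenPairs (ℕ.suc p) q ≃ (Γ (ℕ.suc p) G (a , f) □ Γ q H (b , g)) ⊕ TokenPairs p (ℕ.suc q)
  TokenPairs-suc p q = record
    { to        = λ u → to u (exactly-q u)
    ; from      = from
    ; to∘from   = λ v → to∘from v (exactly-q (from v))
    ; from∘to   = λ u → from∘to u (exactly-q u)
    ; to-edge   = λ {u} {v} → to-edge u v (exactly-q u) (exactly-q v)
    ; from-edge = λ { {inj₁ _} {inj₁ _} → □⇒split ; {inj₂ _} {inj₂ _} → id }
    }
    where
    Layer = Γ (ℕ.suc p) G (a , f) □ Γ q H (b , g)

    exactly-q : (u : V (TokenPairs (ℕ.suc p) q)) → Dec (∣ proj₂ (proj₁ u) ∣ ≡ q)
    exactly-q ((_ , t) , _) = ∣ t ∣ ℕ.≟ q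

    to : (u : V (TokenPairs (ℕ.suc p) q)) → Dec (∣ proj₂ (proj₁ u) ∣ ≡ q) →
      V (Layer ⊕ TokenPairs p (ℕ.suc q))
    to ((s , t) , sizes , _) (yes ∣t∣≡q) =
      inj₁ ((s , ℕ.+-cancelʳ-≡ _ _ _ (trans sizes (cong (ℕ.suc p +_) (sym ∣t∣≡q)))) , (t , ∣t∣≡q))
    to ((s , t) , sizes , q≤∣t∣) (no ∣t∣≢q) =
      inj₂ ((s , t) , trans sizes (sym (ℕ.+-suc p q)) , ℕ.≤∧≢⇒< q≤∣t∣ (∣t∣≢q ∘ sym))

    from : V (Layer ⊕ TokenPairs p (ℕ.suc q)) → V (TokenPairs (ℕ.suc p) q)
    from (inj₁ ((s , ∣s∣) , (t , ∣t∣))) = (s , t) , cong₂ _+_ ∣s∣ ∣t∣ , ℕ.≤-reflexive (sym ∣t∣)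
    from (inj₂ ((s , t) , sizes , q<∣t∣)) = (s , t) , trans sizes (ℕ.+-suc p q) , ℕ.<⇒≤ q<∣t∣

    to∘from : ∀ v d → to (from v) d ≡ v
    to∘from (inj₁ _) (yes _)    = cong inj₁ (cong₂ _,_ (tokens-≡ refl) (tokens-≡ refl))
    to∘from (inj₁ (_ , (_ , ∣t∣≡q))) (no ∣t∣≢q) = ⊥-elim (∣t∣≢q ∣t∣≡q)
    to∘from (inj₂ (_ , _ , q<∣t∣)) (yes ∣t∣≡q) = ⊥-elim (ℕ.<-irrefl (sym ∣t∣≡q) q<∣t∣)
    to∘from (inj₂ _) (no _)     = cong inj₂ (pair-≡ refl)

    from∘to : ∀ u d → from (to u d) ≡ u
    from∘to _ (yes _) = pair-≡ refl
    from∘to _ (no _)  = pair-≡ refl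

    to-edge : ∀ u v du dv → E (TokenPairs (ℕ.suc p) q) u v →
      E (Layer ⊕ TokenPairs p (ℕ.suc q)) (to u du) (to v dv)
    to-edge _ _ (yes _) (yes _) slide = split⇒□ slide
    to-edge _ _ (no _)  (no _)  slide = slide
    to-edge u v (yes ∣t∣≡q) (no ∣t′∣≢q) slide =
      ⊥-elim (∣t′∣≢q (trans (sym (tokens-on-H-invariant {u = u} {v} slide)) ∣t∣≡q))
    to-edge u v (no ∣t∣≢q) (yes ∣t′∣≡q) slide =
      ⊥-elim (∣t∣≢q (trans (tokens-on-H-invariant {u = u} {v} slide) ∣t′∣≡q))

  TokenPairs≃Γ-convolution : ∀ p q → TokenPairs p q ≃ Γ-convolution p q
  TokenPairs≃Γ-convolution ℕ.zero    q = TokenPairs-zero q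
  TokenPairs≃Γ-convolution (ℕ.suc p) q =
    ≃-trans (TokenPairs-suc p q) (⊕-congˡ (TokenPairs≃Γ-convolution p (ℕ.suc q)))

  Γ-⊕≃TokenPairs : ∀ k → Γ k (G ⊕ H) (⊕-finite G H (a , f) (b , g)) ≃ TokenPairs k 0
  Γ-⊕≃TokenPairs k = record
    { to        = λ (S , ∣S∣≡k) → (take a S , drop a S) , sizes S ∣S∣≡k , z≤n
    ; from      = λ ((s , t) , sizes , _) →
                    s ++ t , trans (∣p++q∣≡∣p∣+∣q∣ s t) (trans sizes (ℕ.+-identityʳ k))
    ; to∘from   = λ ((s , t) , _) → pair-≡ (cong₂ _,_ (take-++ s t) (drop-++ s t))
    ; from∘to   = λ (S , _) → tokens-≡ (take++drop≡id a S)
    ; to-edge   = λ { {S , _} {S′ , _} slide →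
                    slide-⊕⇒split (subst₂ (Slide (G ⊕ H) F)
                      (sym (take++drop≡id a S)) (sym (take++drop≡id a S′)) slide) }
    ; from-edge = split⇒slide-⊕
    }
    where
    sizes : (S : Subset (a + b)) → ∣ S ∣ ≡ k → ∣ take a S ∣ + ∣ drop a S ∣ ≡ k + 0
    sizes S ∣S∣≡k = begin
      ∣ take a S ∣ + ∣ drop a S ∣ ≡⟨ sym (∣p++q∣≡∣p∣+∣q∣ (take a S) (drop a S)) ⟩
      ∣ take a S ++ drop a S ∣    ≡⟨ cong ∣_∣ (take++drop≡id a S) ⟩
      ∣ S ∣                       ≡⟨ ∣S∣≡k ⟩
      k                           ≡⟨ sym (ℕ.+-identityʳ k) ⟩
      k + 0                       ∎
      where open ≡-Reasoning

  Γ-⊕ : ∀ k → Γ k (G ⊕ H) (⊕-finite G H (a , f) (b , g)) ≃ Γ-convolution k 0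
  Γ-⊕ k = ≃-trans (Γ-⊕≃TokenPairs k) (TokenPairs≃Γ-convolution k 0)

Γ-zero-□ : (G : Graph) (w : Finite G) (X : Graph) → Γ 0 G w □ X ≃ X
Γ-zero-□ G w X = ≃-trans (□-cong (Γ-zero G w) ≃-refl) (□-identityˡ X)

□-Γ-zero : (X : Graph) (H : Graph) (w : Finite H) → X □ Γ 0 H w ≃ X
□-Γ-zero X H w = ≃-trans (□-cong ≃-refl (Γ-zero H w)) (□-identityʳ X)

Γ₂-⊕ : (G H : Graph) (wG : Finite G) (wH : Finite H) → IsSimple G → IsSimple H →
  Γ 2 (G ⊕ H) (⊕-finite G H wG wH) ≃ Γ 2 G wG ⊕ (G □ H) ⊕ Γ 2 H wH
Γ₂-⊕ G H wG@(_ , f) wH@(_ , g) simple-G simple-H = ≃-trans (Γ-⊕ G H f g 2)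
  (⊕-cong (□-Γ-zero _ H wH)
  (⊕-cong (□-cong (Γ-one G wG simple-G) (Γ-one H wH simple-H))
          (Γ-zero-□ G wG _)))

Γ₃-⊕ : (G H : Graph) (wG : Finite G) (wH : Finite H) → IsSimple G → IsSimple H →
  Γ 3 (G ⊕ H) (⊕-finite G H wG wH) ≃ Γ 3 G wG ⊕ (Γ 2 G wG □ H) ⊕ (G □ Γ 2 H wH) ⊕ Γ 3 H wH
Γ₃-⊕ G H wG@(_ , f) wH@(_ , g) simple-G simple-H = ≃-trans (Γ-⊕ G H f g 3)
  (⊕-cong (□-Γ-zero _ H wH)
  (⊕-cong (□-cong ≃-refl (Γ-one H wH simple-H))
  (⊕-cong (□-cong (Γ-one G wG simple-G) ≃-refl)
          (Γ-zero-□ G wG _))))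

-- Peeling off the first summand

open import Relation.Binary.Reasoning.Setoid ≃-setoid

suc<suc : ∀ {n} (i j : Fin n) → ⌊ suc i <? suc j ⌋ ≡ ⌊ i <? j ⌋
suc<suc i j = trans (⌊⌋-map′ _ _ _) (sym (⌊⌋-map′ _ _ _))

suc≟suc : ∀ {n} (i j : Fin n) → ⌊ suc i ≟ suc j ⌋ ≡ ⌊ i ≟ j ⌋
suc≟suc i j = ⌊⌋-map′ _ _ (i ≟ j)

⨁-when-suc< : ∀ n c j (X : Fin (ℕ.suc n) → Graph) →
  ⨁ (ℕ.suc n) (λ k → when (c ∧ ⌊ suc j <? k ⌋) (X k))
    ≃ ⨁ n (λ k → when (c ∧ ⌊ j <? k ⌋) (X (suc k)))
⨁-when-suc< n c j X = ≃-trans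
  (⊕-cong (when-≃ (∧-zeroʳ c) ≃-refl) (⨁-cong n λ k → when-≃ (cong (c ∧_) (suc<suc j k)) ≃-refl))
  (⊕-identityˡ _)

⨁□₂ : ∀ n → (Fin n → Graph) → Graph
⨁□₂ n G = ⨁ n λ i → ⨁ n λ j → when ⌊ i <? j ⌋ (G i □ G j)

⨁□₃ : ∀ n → (Fin n → Graph) → Graph
⨁□₃ n G = ⨁ n λ i → ⨁ n λ j → ⨁ n λ k → when (⌊ i <? j ⌋ ∧ ⌊ j <? k ⌋) (G i □ G j □ G k)

⨁Γ₂□ : ∀ n (G : Fin n → Graph) → (∀ i → Finite (G i)) → Graph
⨁Γ₂□ n G fin = ⨁ n λ i → ⨁ n λ j → when (not ⌊ i ≟ j ⌋) (Γ 2 (G i) (fin i) □ G j)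

⨁□₂-suc : ∀ n (G : Fin (ℕ.suc n) → Graph) →
  ⨁□₂ (ℕ.suc n) G ≃ (G zero □ ⨁ n (G ∘ suc)) ⊕ ⨁□₂ n (G ∘ suc)
⨁□₂-suc n G = ⊕-cong
  (≃-trans (⊕-identityˡ _) (≃-sym (□-distribˡ-⨁ n (G zero) (G ∘ suc))))
  (⨁-cong n λ i → ⨁-when-suc< n true i (λ j → G (suc i) □ G j))

⨁□₃-suc : ∀ n (G : Fin (ℕ.suc n) → Graph) →
  ⨁□₃ (ℕ.suc n) G ≃ (G zero □ ⨁□₂ n (G ∘ suc)) ⊕ ⨁□₃ n (G ∘ suc)
⨁□₃-suc n G = ⊕-cong row₀ (⨁-cong n row)
  where
  G₀ = G zero

  row₀ : ⨁ (ℕ.suc n) (λ j → ⨁ (ℕ.suc n) λ k → when (⌊ zero {n} <? j ⌋ ∧ ⌊ j <? k ⌋) (G₀ □ G j □ G k))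
         ≃ G₀ □ ⨁□₂ n (G ∘ suc)
  row₀ = begin
    ⨁ (ℕ.suc n) (λ _ → ∅) ⊕ ⨁ n (λ j → ⨁ (ℕ.suc n) λ k → when ⌊ suc j <? k ⌋ (G₀ □ G (suc j) □ G k))
      ≈⟨ ⊕-cong (⨁-zero (ℕ.suc n))
                (⨁-cong n λ j → ⨁-when-suc< n true j (λ k → G₀ □ G (suc j) □ G k)) ⟩
    ∅ ⊕ ⨁ n (λ j → ⨁ n λ k → when ⌊ j <? k ⌋ (G₀ □ G (suc j) □ G (suc k)))
      ≈⟨ ⊕-identityˡ _ ⟩
    ⨁ n (λ j → ⨁ n λ k → when ⌊ j <? k ⌋ (G₀ □ G (suc j) □ G (suc k)))
      ≈⟨ ⨁-cong n (λ j → ⨁-cong n λ k →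
           ≃-trans (when-≃ refl (□-assoc _ _ _)) (≃-sym (□-when G₀ _ _))) ⟩
    ⨁ n (λ j → ⨁ n λ k → G₀ □ when ⌊ j <? k ⌋ (G (suc j) □ G (suc k)))
      ≈⟨ ≃-sym (≃-trans (□-distribˡ-⨁ n G₀ _) (⨁-cong n λ j → □-distribˡ-⨁ n G₀ _)) ⟩
    G₀ □ ⨁□₂ n (G ∘ suc) ∎

  row : ∀ i →
    ⨁ (ℕ.suc n) (λ j → ⨁ (ℕ.suc n) λ k →
      when (⌊ suc i <? j ⌋ ∧ ⌊ j <? k ⌋) (G (suc i) □ G j □ G k))
    ≃ ⨁ n (λ j → ⨁ n λ k →
      when (⌊ i <? j ⌋ ∧ ⌊ j <? k ⌋) (G (suc i) □ G (suc j) □ G (suc k)))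
  row i = ≃-trans
    (⊕-cong (⨁-zero (ℕ.suc n)) (⨁-cong n λ j →
      ≃-trans (⨁-when-suc< n ⌊ suc i <? suc j ⌋ j (λ k → G (suc i) □ G (suc j) □ G k))
              (⨁-cong n λ k → when-≃ (cong (_∧ _) (suc<suc i j)) ≃-refl)))
    (⊕-identityˡ _)

⨁Γ₂□-suc : ∀ n (G : Fin (ℕ.suc n) → Graph) (fin : ∀ i → Finite (G i)) →
  ⨁Γ₂□ (ℕ.suc n) G fin ≃
    (Γ 2 (G zero) (fin zero) □ ⨁ n (G ∘ suc))
    ⊕ (⨁ n (λ i → Γ 2 (G (suc i)) (fin (suc i))) □ G zero) ⊕ ⨁Γ₂□ n (G ∘ suc) (fin ∘ suc)
⨁Γ₂□-suc n G fin = ⊕-cong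
  (≃-trans (⊕-identityˡ _) (≃-sym (□-distribˡ-⨁ n _ (G ∘ suc))))
  (≃-trans
    (⨁-cong n λ i → ⊕-congˡ (⨁-cong n λ j → when-≃ (cong not (suc≟suc i j)) ≃-refl))
    (≃-trans (⨁-distrib-⊕ n _ _) (⊕-cong (≃-sym (□-distribʳ-⨁ n (G zero) _)) ≃-refl)))

⊕-simple : (G H : Graph) → IsSimple G → IsSimple H → IsSimple (G ⊕ H)
⊕-simple G H (sym-G , irrefl-G) (sym-H , irrefl-H) =
  (λ { (inj₁ x) (inj₁ y) → sym-G x y ; (inj₂ x) (inj₂ y) → sym-H x y }) ,
  [ irrefl-G , irrefl-H ]

⨁-simple : ∀ n (G : Fin n → Graph) → (∀ i → IsSimple (G i)) → IsSimple (⨁ n G)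
⨁-simple ℕ.zero    G simple = (λ ()) , (λ ())
⨁-simple (ℕ.suc n) G simple = ⊕-simple _ _ (simple zero) (⨁-simple n (G ∘ suc) (simple ∘ suc))

Γ₂-⨁ : ∀ n (G : Fin n → Graph) (fin : ∀ i → Finite (G i)) → (∀ i → IsSimple (G i)) →
  Γ 2 (⨁ n G) (⨁-finite n G fin) ≃ ⨁ n (λ i → Γ 2 (G i) (fin i)) ⊕ ⨁□₂ n G
Γ₂-⨁ ℕ.zero    G fin simple = ≃-trans (Γ-∅ 1 (↔-sym 0↔⊥)) (≃-sym (⊕-identityʳ ∅))
Γ₂-⨁ (ℕ.suc n) G fin simple = begin
  Γ 2 (G₀ ⊕ S) (⨁-finite (ℕ.suc n) G fin)
    ≈⟨ Γ₂-⊕ G₀ S (fin zero) finS (simple zero) (⨁-simple n (G ∘ suc) (simple ∘ suc)) ⟩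
  Γ 2 G₀ (fin zero) ⊕ (G₀ □ S) ⊕ Γ 2 S finS
    ≈⟨ ⊕-congˡ (⊕-congˡ (Γ₂-⨁ n (G ∘ suc) (fin ∘ suc) (simple ∘ suc))) ⟩
  Γ 2 G₀ (fin zero) ⊕ (G₀ □ S) ⊕ (A ⊕ P)
    ≈⟨ solve 4 (λ a b c d → a ⊕ₑ b ⊕ₑ c ⊕ₑ d ⊜ (a ⊕ₑ c) ⊕ₑ b ⊕ₑ d) ≃-refl _ _ _ _ ⟩
  (Γ 2 G₀ (fin zero) ⊕ A) ⊕ (G₀ □ S) ⊕ P
    ≈⟨ ⊕-congˡ (≃-sym (⨁□₂-suc n G)) ⟩
  ⨁ (ℕ.suc n) (λ i → Γ 2 (G i) (fin i)) ⊕ ⨁□₂ (ℕ.suc n) G ∎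
  where
  G₀ = G zero
  S = ⨁ n (G ∘ suc)
  finS = ⨁-finite n (G ∘ suc) (fin ∘ suc)
  A = ⨁ n (λ i → Γ 2 (G (suc i)) (fin (suc i)))
  P = ⨁□₂ n (G ∘ suc)

Γ₃-⨁ : ∀ n (G : Fin n → Graph) (fin : ∀ i → Finite (G i)) → (∀ i → IsSimple (G i)) →
  Γ 3 (⨁ n G) (⨁-finite n G fin) ≃ ⨁ n (λ i → Γ 3 (G i) (fin i)) ⊕ ⨁Γ₂□ n G fin ⊕ ⨁□₃ n G
Γ₃-⨁ ℕ.zero    G fin simple =
  ≃-trans (Γ-∅ 2 (↔-sym 0↔⊥)) (≃-sym (≃-trans (⊕-identityˡ _) (⊕-identityʳ ∅)))
Γ₃-⨁ (ℕ.suc n) G fin simple = begin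
  Γ 3 (G₀ ⊕ S) (⨁-finite (ℕ.suc n) G fin)
    ≈⟨ Γ₃-⊕ G₀ S (fin zero) finS (simple zero) (⨁-simple n (G ∘ suc) (simple ∘ suc)) ⟩
  Γ 3 G₀ (fin zero) ⊕ (Γ 2 G₀ (fin zero) □ S) ⊕ (G₀ □ Γ 2 S finS) ⊕ Γ 3 S finS
    ≈⟨ ⊕-congˡ (⊕-congˡ (⊕-cong (□-cong ≃-refl (Γ₂-⨁ n (G ∘ suc) (fin ∘ suc) (simple ∘ suc)))
                                (Γ₃-⨁ n (G ∘ suc) (fin ∘ suc) (simple ∘ suc)))) ⟩
  Γ 3 G₀ (fin zero) ⊕ (Γ 2 G₀ (fin zero) □ S) ⊕ (G₀ □ (A₂ ⊕ P)) ⊕ (A₃ ⊕ B ⊕ T)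
    ≈⟨ ⊕-congˡ (⊕-congˡ (⊕-cong (≃-trans (□-distribˡ-⊕ G₀ A₂ P) (⊕-cong (□-comm G₀ A₂) ≃-refl))
                                ≃-refl)) ⟩
  Γ 3 G₀ (fin zero) ⊕ (Γ 2 G₀ (fin zero) □ S) ⊕ ((A₂ □ G₀) ⊕ (G₀ □ P)) ⊕ (A₃ ⊕ B ⊕ T)
    ≈⟨ solve 7 (λ a b c d e f g → a ⊕ₑ b ⊕ₑ (c ⊕ₑ d) ⊕ₑ (e ⊕ₑ f ⊕ₑ g)
                                 ⊜ (a ⊕ₑ e) ⊕ₑ (b ⊕ₑ c ⊕ₑ f) ⊕ₑ (d ⊕ₑ g)) ≃-refl _ _ _ _ _ _ _ ⟩
  (Γ 3 G₀ (fin zero) ⊕ A₃) ⊕ ((Γ 2 G₀ (fin zero) □ S) ⊕ (A₂ □ G₀) ⊕ B) ⊕ ((G₀ □ P) ⊕ T)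
    ≈⟨ ⊕-congˡ (⊕-cong (≃-sym (⨁Γ₂□-suc n G fin)) (≃-sym (⨁□₃-suc n G))) ⟩
  ⨁ (ℕ.suc n) (λ i → Γ 3 (G i) (fin i)) ⊕ ⨁Γ₂□ (ℕ.suc n) G fin ⊕ ⨁□₃ (ℕ.suc n) G ∎
  where
  G₀ = G zero
  S = ⨁ n (G ∘ suc)
  finS = ⨁-finite n (G ∘ suc) (fin ∘ suc)
  A₂ = ⨁ n (λ i → Γ 2 (G (suc i)) (fin (suc i)))
  A₃ = ⨁ n (λ i → Γ 3 (G (suc i)) (fin (suc i)))
  P = ⨁□₂ n (G ∘ suc)
  B = ⨁Γ₂□ n (G ∘ suc) (fin ∘ suc)
  T = ⨁□₃ n (G ∘ suc)

theorem2 : (n : ℕ) → 2 ≤ n → (G : Fin n → Graph) → (fin : (i : Fin n) → Finite (G i)) →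
    (∀ i → IsSimple (G i)) →
    Γ 3 (⨁ n G) (⨁-finite n G fin)
      ≅ (⨁ n (λ i → Γ 3 (G i) (fin i))
         ⊕ ⨁ n (λ i → ⨁ n (λ j → when (not ⌊ i ≟ j ⌋) (Γ 2 (G i) (fin i) □ G j)))
         ⊕ ⨁ n (λ i → ⨁ n (λ j → ⨁ n (λ k →
              when (⌊ i <? j ⌋ ∧ ⌊ j <? k ⌋) (G i □ G j □ G k)))))
theorem2 n _ G fin simple = ≃⇒≅ (Γ₃-⨁ n G fin simple)
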